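{- Let $k\ge 1$ be an integer, let $G$ be a weighted graph as described in the context, let $f:V(G)\to\{0,1,\dots,4k^2-1\}$ be any function, and let $H$ be any subgraph of $G$. Then the compact subgraph $\mathcal{C}_f(H)$ has nice $k$-matchings if and only if the reduced compact subgraph $\mathcal{R}_f(H)$ has nice $k$-matchings. If this is the case, then the weight of a maximum weighted nice $k$-matching in $\mathcal{C}_f(H)$ is equal to the weight of a maximum weighted nice $k$-matching in $\mathcal{R}_f(H)$.
   Context: $G=(V,E)$ is a simple undirected graph with $V=\{0,1,\dots,n-1\}$ and edge weight function $wt:E\to\mathbb{R}_{\ge 0}$. For an edge $e=[u,v]$ with $u<v$ define $\beta(e)=(wt(e),u,v)$; edges are totally ordered by the lexicographic order of their $\beta$-values, and the "$i$-th heaviest edge" of an edge set is the edge with the $i$-th largest $\beta$-value in that set. A $k$-matching is a matching with exactly $k$ edges; its weight is the sum of $wt$ over its edges. For $f:V\to\{0,\dots,4k^2-1\}$ let $V_i=\{v\in V: f(v)=i\}$. A matching $M$ is nice (w.r.t. $f$) if no two endpoints of edges of $M$ belong to the same set $V_i$. For a subgraph $H$ of $G$, the compact subgraph $\mathcal{C}_f(H)$ is the subgraph of $H$ consisting of the edges $e$ of $H$ whose two endpoints lie in two distinct sets $V_i,V_j$ and such that $\beta(e)$ is maximum over all edges of $H$ between $V_i$ and $V_j$. Let $\mathcal{R}'_f(H)$ be obtained from $\mathcal{C}_f(H)$ by deleting every edge $[u,v]$ with $u\in V_i$, $v\in V_j$ ($i\ne j$) that is either not among the $2k$ heaviest edges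 of $\mathcal{C}_f(H)$ incident to vertices in $V_i$ or not among the $2k$ heaviest edges of $\mathcal{C}_f(H)$ incident to vertices in $V_j$. The reduced compact subgraph $\mathcal{R}_f(H)$ is obtained from $\mathcal{R}'_f(H)$ by deleting every edge that is not among the $4k^2$ heaviest edges of $\mathcal{R}'_f(H)$.
   Formalization: The edge weights take values in the nonnegative rationals instead of the nonnegative reals. -}

module Defs where

open import Data.Bool using (Bool; true; false; _∧_; _∨_; not; if_then_else_)
open import Data.Nat as ℕ using (ℕ; _*_)
open import Data.Fin as Fin using (Fin; toℕ)
open import Data.Fin.Properties as FinP using ()
open import Data.Product using (_×_; _,_; proj₁; proj₂; ∃-syntax)
open import Data.List using (List; []; _∷_; map; filter; length; concatMap; foldr)
open import Data.List.Base using (allFin)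
open import Data.List.Relation.Unary.All using (All)
open import Data.List.Relation.Unary.Unique.Propositional using (Unique)
open import Data.Rational as ℚ using (ℚ; 0ℚ)
import Data.Rational.Properties as ℚP
open import Relation.Nullary using (does)
open import Relation.Binary.PropositionalEquality using (_≡_)

-- An (undirected) edge [u,v] is represented by the ordered pair (u , v) with u < v.
Edge : ℕ → Set
Edge n = Fin n × Fin n

-- A set of edges on vertex set V = {0,…,n-1}: a Boolean predicate on pairs;
-- only pairs (u , v) with u < v are considered (see _∈ₑ_).
EdgeSet : ℕ → Set
EdgeSet n = Fin n → Fin n → Bool

memᵇ : ∀ {n} → EdgeSet n → Edge n → Bool
memᵇ S (u , v) = S u v ∧ (toℕ u ℕ.<ᵇ toℕ v)

_∈ₑ_ : ∀ {n} → Edge n → EdgeSet n → Set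
e ∈ₑ S = memᵇ S e ≡ true

_⊆ₑ_ : ∀ {n} → EdgeSet n → EdgeSet n → Set
_⊆ₑ_ {n} H E = ∀ (e : Edge n) → e ∈ₑ H → e ∈ₑ E

allPairs : (n : ℕ) → List (Edge n)
allPairs n = concatMap (λ u → map (λ v → (u , v)) (allFin n)) (allFin n)

countᵇ : ∀ {A : Set} → (A → Bool) → List A → ℕ
countᵇ p []       = 0
countᵇ p (x ∷ xs) = if p x then ℕ.suc (countᵇ p xs) else countᵇ p xs

allᵇ : ∀ {A : Set} → (A → Bool) → List A → Bool
allᵇ p []       = true
allᵇ p (x ∷ xs) = p x ∧ allᵇ p xs

_=ᶠ_ : ∀ {m} → Fin m → Fin m → Bool
i =ᶠ j = does (i Fin.≟ j)

-- Edge weights: values are only relevant on edges of G.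
Weight : ℕ → Set
Weight n = Fin n → Fin n → ℚ

-- β(e) > β(e') for β([u,v]) = (wt(u,v), u, v), lexicographic order.
_⊢_>β_ : ∀ {n} → Weight n → Edge n → Edge n → Bool
wt ⊢ (u , v) >β (u′ , v′) =
  does (wt u′ v′ ℚP.<? wt u v)
  ∨ (does (wt u v ℚP.≟ wt u′ v′)
     ∧ ((toℕ u′ ℕ.<ᵇ toℕ u) ∨ ((u =ᶠ u′) ∧ (toℕ v′ ℕ.<ᵇ toℕ v))))

colours : ℕ → ℕ
colours k = 4 * k * k

Colouring : ℕ → ℕ → Set
Colouring n k = Fin n → Fin (colours k)

module _ {n : ℕ} (k : ℕ) (wt : Weight n) (f : Colouring n k) where

  sameClasses : Edge n → Edge n → Bool
  sameClasses (u , v) (u′ , v′) =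
    ((f u′ =ᶠ f u) ∧ (f v′ =ᶠ f v)) ∨ ((f u′ =ᶠ f v) ∧ (f v′ =ᶠ f u))

  incidentTo : Fin (colours k) → Edge n → Bool
  incidentTo i (u′ , v′) = (f u′ =ᶠ i) ∨ (f v′ =ᶠ i)

  compact : EdgeSet n → EdgeSet n
  compact H u v =
    memᵇ H (u , v) ∧ not (f u =ᶠ f v)
    ∧ allᵇ (λ e′ → not (memᵇ H e′ ∧ sameClasses (u , v) e′ ∧ (wt ⊢ e′ >β (u , v))))
          (allPairs n)

  amongHeaviestAt : EdgeSet n → ℕ → Fin (colours k) → Edge n → Bool
  amongHeaviestAt S m i e =
    countᵇ (λ e′ → memᵇ S e′ ∧ incidentTo i e′ ∧ (wt ⊢ e′ >β e)) (allPairs n) ℕ.<ᵇ m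

  amongHeaviest : EdgeSet n → ℕ → Edge n → Bool
  amongHeaviest S m e =
    countᵇ (λ e′ → memᵇ S e′ ∧ (wt ⊢ e′ >β e)) (allPairs n) ℕ.<ᵇ m

  reducedCompact′ : EdgeSet n → EdgeSet n
  reducedCompact′ H u v =
    let C = compact H in
    memᵇ C (u , v)
    ∧ amongHeaviestAt C (2 * k) (f u) (u , v)
    ∧ amongHeaviestAt C (2 * k) (f v) (u , v)

  reducedCompact : EdgeSet n → EdgeSet n
  reducedCompact H u v =
    let R′ = reducedCompact′ H in
    memᵇ R′ (u , v) ∧ amongHeaviest R′ (colours k) (u , v)

  endpoints : List (Edge n) → List (Fin n)
  endpoints = concatMap (λ e → proj₁ e ∷ proj₂ e ∷ [])

  IsMatching : List (Edge n) → Set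
  IsMatching M = Unique (endpoints M)

  IsNice : List (Edge n) → Set
  IsNice M = Unique (map f (endpoints M))

  IsNiceKMatching : EdgeSet n → List (Edge n) → Set
  IsNiceKMatching S M =
    length M ≡ k × All (λ e → e ∈ₑ S) M × IsMatching M × IsNice M

  HasNiceKMatching : EdgeSet n → Set
  HasNiceKMatching S = ∃[ M ] IsNiceKMatching S M

  weight : List (Edge n) → ℚ
  weight M = foldr (λ e acc → wt (proj₁ e) (proj₂ e) ℚ.+ acc) 0ℚ M

  IsMaxNiceKMatchingWeight : EdgeSet n → ℚ → Set
  IsMaxNiceKMatchingWeight S w =
    (∃[ M ] (IsNiceKMatching S M × weight M ≡ w))
    × (∀ M → IsNiceKMatching S M → weight M ℚ.≤ w)

{-# OPTIONS --safe #-}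
module Submission where

-- An exchange argument. Let M be a nice k-matching of S and e ∈ M an edge outside T ⊆ S.
-- The other k − 1 edges of M use 2(k − 1) colour classes. If the S-edges β-heavier than e
-- that qualify as replacements outnumber 2(k − 1)·B, where each colour class meets at most
-- B of them, then one of them avoids all those classes and can replace e: M stays nice and
-- its weight does not drop. Each exchange decreases the total number of S-edges heavier
-- than the edges of M, so repeating it yields a nice k-matching inside T.
--   C → R′: e is not among the 2k heaviest C-edges at a class V_i of one of its ends, and
--     C joins V_i to any other class by at most one edge (B = 1, 2(k − 1) < 2k).
--   R′ → R: e is not among the 4k² heaviest R′-edges, and each class meets at most 2k
--     edges of R′ (B = 2k, 2(k − 1)·2k < 4k²).
-- So every nice k-matching of C is dominated by one of R ⊆ C; both claims follow, the
-- maxima existing because there are finitely many k-matchings.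

open import Defs

open import Data.Bool using (Bool; true; false; _∧_; _∨_; not)
open import Data.Bool.ListAction using (any)
open import Data.Bool.Properties using (T-≡; not-injective; ∧-zeroʳ; ∧-assoc)
import Data.Bool as Bool
open import Data.Empty using (⊥-elim)
open import Data.Fin as Fin using (Fin; toℕ)
open import Data.Fin.Properties using (toℕ-injective)
open import Data.List using (List; []; _∷_; _++_; length; map; filter; allFin; concatMap; cartesianProduct; cartesianProductWith)
open import Data.List.Membership.Propositional using (_∈_; _∉_)
open import Data.List.Membership.Propositional.Properties
  using (∈-allFin; ∈-cartesianProductWith⁺; ∈-filter⁺)
open import Data.List.Relation.Unary.Any using (here; there)
open import Data.List.Relation.Unary.All as All using (All; []; _∷_)
open import Data.List.Relation.Unary.All.Properties using (all-filter; ¬Any⇒All¬)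
open import Data.List.Relation.Unary.AllPairs using (_∷_)
open import Data.List.Relation.Unary.Unique.Propositional using (Unique)
open import Data.List.Relation.Unary.Unique.Propositional.Properties
  using (map⁻; cartesianProductWith⁺; allFin⁺; Unique[x∷xs]⇒x∉xs)
import Data.List.Relation.Unary.Unique.DecPropositional as UniqueDec
open import Data.List.Relation.Binary.Permutation.Propositional using (_↭_; refl; prep; swap; trans; ↭-sym; ↭⇒↭ₛ)
import Data.List.Relation.Binary.Permutation.Propositional.Properties as ↭
open import Data.List.Relation.Binary.Permutation.Setoid.Properties using (Unique-resp-↭)
import Data.List.Extrema as Extrema
open import Data.Nat as ℕ using (ℕ; zero; suc; _+_; _*_; _<ᵇ_; _≥_; z≤n; s≤s)
import Data.Nat.Properties as ℕP
open import Data.Nat.ListAction using (sum)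
open import Data.Nat.ListAction.Properties using (sum-↭)
open import Data.Nat.Induction using (<-wellFounded)
open import Data.Nat.Tactic.RingSolver using (solve-∀)
open import Data.Product using (_×_; _,_; proj₁; proj₂; ∃-syntax)
open import Data.Product.Properties using (≡-dec)
open import Data.Rational as ℚ using (ℚ; 0ℚ; _≤_)
import Data.Rational.Properties as ℚP
open import Data.Sum using (_⊎_; inj₁; inj₂)
open import Function.Base using (_∘′_)
open import Function.Bundles using (_⇔_; mk⇔; Equivalence)
open import Induction.WellFounded using (Acc; acc)
open import Relation.Binary.Bundles using (DecTotalOrder)
open import Relation.Binary.Definitions using (tri<; tri≈; tri>)
open import Relation.Binary.PropositionalEquality
  using (_≡_; _≢_; refl; sym; cong; cong₂; subst; setoid; module ≡-Reasoning) renaming (trans to ≡-trans)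
open import Relation.Nullary using (¬_; Dec; yes; no; does; contradiction)
open import Relation.Nullary.Decidable using (dec-true; _×-dec_)

∧-elimˡ : ∀ {a b} → a ∧ b ≡ true → a ≡ true
∧-elimˡ {true} _ = refl

∧-elimʳ : ∀ {a b} → a ∧ b ≡ true → b ≡ true
∧-elimʳ {true} h = h

∧-intro : ∀ {a b} → a ≡ true → b ≡ true → a ∧ b ≡ true
∧-intro refl h = h

∨-elim : ∀ {a b} → a ∨ b ≡ true → a ≡ true ⊎ b ≡ true
∨-elim {true} _ = inj₁ refl
∨-elim {false} h = inj₂ h

∨-introˡ : ∀ {a b} → a ≡ true → a ∨ b ≡ true
∨-introˡ refl = refl

∨-introʳ : ∀ {a b} → b ≡ true → a ∨ b ≡ true
∨-introʳ {true} _ = refl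
∨-introʳ {false} h = h

∨-false : ∀ {a b} → a ∨ b ≡ false → a ≡ false × b ≡ false
∨-false {false} h = refl , h

¬true⇒false : ∀ {a} → ¬ a ≡ true → a ≡ false
¬true⇒false {false} _ = refl
¬true⇒false {true} h = ⊥-elim (h refl)

true≢false : ∀ {a} → a ≡ true → a ≢ false
true≢false refl ()

does⇒ : ∀ {P : Set} (p? : Dec P) → does p? ≡ true → P
does⇒ (yes p) _ = p

<ᵇ⇒< : ∀ {a b} → (a <ᵇ b) ≡ true → a ℕ.< b
<ᵇ⇒< {a} {b} h = ℕP.<ᵇ⇒< a b (Equivalence.from T-≡ h)

≮ᵇ⇒≥ : ∀ {a b} → (a <ᵇ b) ≡ false → b ℕ.≤ a
≮ᵇ⇒≥ h = ℕP.≮⇒≥ (λ a<b → true≢false (Equivalence.to T-≡ (ℕP.<⇒<ᵇ a<b)) h)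

=ᶠ⇒≡ : ∀ {m} (i j : Fin m) → (i =ᶠ j) ≡ true → i ≡ j
=ᶠ⇒≡ i j = does⇒ (i Fin.≟ j)

≡⇒=ᶠ : ∀ {m} {i j : Fin m} → i ≡ j → (i =ᶠ j) ≡ true
≡⇒=ᶠ {i = i} {j} = dec-true (i Fin.≟ j)

module _ {A : Set} where

  countᵇ-mono : ∀ {p q : A → Bool} xs → (∀ x → x ∈ xs → p x ≡ true → q x ≡ true)
              → countᵇ p xs ℕ.≤ countᵇ q xs
  countᵇ-mono [] _ = z≤n
  countᵇ-mono {p} {q} (x ∷ xs) p⇒q with p x in px | q x in qx
  ... | true  | true  = s≤s (countᵇ-mono xs λ y y∈ → p⇒q y (there y∈))
  ... | true  | false = contradiction (p⇒q x (here refl) px) (λ qx′ → true≢false qx′ qx)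
  ... | false | true  = ℕP.m≤n⇒m≤1+n (countᵇ-mono xs λ y y∈ → p⇒q y (there y∈))
  ... | false | false = countᵇ-mono xs λ y y∈ → p⇒q y (there y∈)

  countᵇ-≤-∷ : ∀ (p : A → Bool) x xs → countᵇ p xs ℕ.≤ countᵇ p (x ∷ xs)
  countᵇ-≤-∷ p x xs with p x
  ... | true  = ℕP.n≤1+n _
  ... | false = ℕP.≤-refl

  countᵇ-cover : ∀ {r p q : A → Bool} xs → (∀ x → x ∈ xs → r x ≡ true → p x ≡ true ⊎ q x ≡ true)
               → countᵇ r xs ℕ.≤ countᵇ p xs + countᵇ q xs
  countᵇ-cover [] _ = z≤n
  countᵇ-cover {r} {p} {q} (x ∷ xs) cover with r x in rx | countᵇ-cover xs (λ y y∈ → cover y (there y∈))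
  ... | false | ih = ℕP.≤-trans ih (ℕP.+-mono-≤ (countᵇ-≤-∷ p x xs) (countᵇ-≤-∷ q x xs))
  ... | true  | ih with p x in px
  ...   | true = s≤s (ℕP.≤-trans ih (ℕP.+-monoʳ-≤ (countᵇ p xs) (countᵇ-≤-∷ q x xs)))
  ...   | false with q x in qx
  ...     | true  = ℕP.≤-trans (s≤s ih) (ℕP.≤-reflexive (sym (ℕP.+-suc _ _)))
  ...     | false with cover x (here refl) rx
  ...       | inj₁ px′ = contradiction px′ (λ h → true≢false h px)
  ...       | inj₂ qx′ = contradiction qx′ (λ h → true≢false h qx)

  countᵇ-zero : ∀ {p : A → Bool} xs → (∀ x → x ∈ xs → p x ≡ false) → countᵇ p xs ≡ 0
  countᵇ-zero [] _ = refl
  countᵇ-zero (x ∷ xs) none rewrite none x (here refl) = countᵇ-zero xs λ y y∈ → none y (there y∈)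

  countᵇ-pos : ∀ {p : A → Bool} xs → 0 ℕ.< countᵇ p xs → ∃[ x ] (x ∈ xs × p x ≡ true)
  countᵇ-pos {p} (x ∷ xs) pos with p x in px
  ... | true  = x , here refl , px
  ... | false with countᵇ-pos xs pos
  ...   | y , y∈ , py = y , there y∈ , py

  countᵇ-strict : ∀ {p q : A → Bool} xs y → (∀ x → p x ≡ true → q x ≡ true)
                → y ∈ xs → p y ≡ false → q y ≡ true → countᵇ p xs ℕ.< countᵇ q xs
  countᵇ-strict (x ∷ xs) y p⇒q (here refl) py qy rewrite py | qy =
    s≤s (countᵇ-mono xs λ z _ → p⇒q z)
  countᵇ-strict {p} {q} (x ∷ xs) y p⇒q (there y∈) py qy with p x in px | q x in qx
  ... | true  | true  = s≤s (countᵇ-strict xs y p⇒q y∈ py qy)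
  ... | true  | false = contradiction (p⇒q x px) (λ h → true≢false h qx)
  ... | false | true  = ℕP.m≤n⇒m≤1+n (countᵇ-strict xs y p⇒q y∈ py qy)
  ... | false | false = countᵇ-strict xs y p⇒q y∈ py qy

  countᵇ-≤1 : ∀ {p : A → Bool} xs → Unique xs
            → (∀ x y → x ∈ xs → y ∈ xs → p x ≡ true → p y ≡ true → x ≡ y)
            → countᵇ p xs ℕ.≤ 1
  countᵇ-≤1 [] _ _ = z≤n
  countᵇ-≤1 {p} (x ∷ xs) uniq@(_ ∷ uniqs) same with p x in px
  ... | true  = s≤s (ℕP.≤-reflexive (countᵇ-zero xs λ y y∈ → ¬true⇒false λ py →
                  Unique[x∷xs]⇒x∉xs uniq (subst (_∈ xs) (same y x (there y∈) (here refl) py px) y∈)))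
  ... | false = countᵇ-≤1 xs uniqs λ a b a∈ b∈ → same a b (there a∈) (there b∈)

  pigeonhole : ∀ {p q r : A → Bool} xs → (∀ x → p x ≡ true → q x ≡ true)
             → countᵇ (λ x → q x ∧ r x) xs ℕ.< countᵇ p xs
             → ∃[ x ] (x ∈ xs × p x ≡ true × r x ≡ false)
  pigeonhole {p} {q} {r} xs p⇒q fewerBlocked =
    let x , x∈ , hit = countᵇ-pos xs free
    in x , x∈ , ∧-elimˡ hit , not-injective (∧-elimʳ {p x} hit)
    where
    split : ∀ x → x ∈ xs → p x ≡ true → (q x ∧ r x) ≡ true ⊎ (p x ∧ not (r x)) ≡ true
    split x _ px with r x
    ... | true  = inj₁ (∧-intro (p⇒q x px) refl)
    ... | false = inj₂ (∧-intro px refl)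
    free : 0 ℕ.< countᵇ (λ x → p x ∧ not (r x)) xs
    free = ℕP.≰⇒> λ none → ℕP.<⇒≱ fewerBlocked
      (ℕP.≤-trans (countᵇ-cover xs split)
        (ℕP.≤-trans (ℕP.+-monoʳ-≤ _ none) (ℕP.≤-reflexive (ℕP.+-identityʳ _))))

allᵇ-∈ : ∀ {A : Set} {p : A → Bool} {x} xs → allᵇ p xs ≡ true → x ∈ xs → p x ≡ true
allᵇ-∈ (_ ∷ _) h (here refl) = ∧-elimˡ h
allᵇ-∈ {p = p} (y ∷ ys) h (there x∈) = allᵇ-∈ ys (∧-elimʳ {p y} h) x∈

listsOfLength : ∀ {A : Set} → ℕ → List A → List (List A)
listsOfLength zero _ = [] ∷ []
listsOfLength (suc m) xs = cartesianProductWith _∷_ xs (listsOfLength m xs)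

∈-listsOfLength : ∀ {A : Set} {xs : List A} → (∀ x → x ∈ xs) → ∀ ys → ys ∈ listsOfLength (length ys) xs
∈-listsOfLength _ [] = here refl
∈-listsOfLength all∈ (y ∷ ys) = ∈-cartesianProductWith⁺ _∷_ (all∈ y) (∈-listsOfLength all∈ ys)

concatMap-pairs≡cartesianProduct : ∀ {A B : Set} (xs : List A) (ys : List B)
                                 → concatMap (λ x → map (λ y → (x , y)) ys) xs ≡ cartesianProduct xs ys
concatMap-pairs≡cartesianProduct [] ys = refl
concatMap-pairs≡cartesianProduct (x ∷ xs) ys =
  cong (map (λ y → (x , y)) ys ++_) (concatMap-pairs≡cartesianProduct xs ys)

allPairs-unique : ∀ n → Unique (allPairs n)
allPairs-unique n rewrite concatMap-pairs≡cartesianProduct (allFin n) (allFin n) =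
  cartesianProductWith⁺ _,_ (λ { refl → refl , refl }) (allFin⁺ n) (allFin⁺ n)

∈-allPairs : ∀ {n} (e : Edge n) → e ∈ allPairs n
∈-allPairs {n} (u , v) rewrite concatMap-pairs≡cartesianProduct (allFin n) (allFin n) =
  ∈-cartesianProductWith⁺ _,_ (∈-allFin u) (∈-allFin v)

unique-↭ : ∀ {A : Set} {xs ys : List A} → xs ↭ ys → Unique xs → Unique ys
unique-↭ p = Unique-resp-↭ (setoid _) (↭⇒↭ₛ p)

double-< : ∀ m → 2 * m ℕ.< 2 * suc m
double-< m = ℕP.*-monoʳ-< 2 (ℕP.n<1+n m)

2k*2k≡4kk : ∀ k → 2 * k * (2 * k) ≡ 4 * k * k
2k*2k≡4kk = solve-∀

double*double-< : ∀ m → 2 * m * (2 * suc m) ℕ.< colours (suc m)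
double*double-< m =
  subst (2 * m * (2 * suc m) ℕ.<_) (2k*2k≡4kk (suc m)) (ℕP.*-monoˡ-< (2 * suc m) (double-< m))

module Heaviness {n : ℕ} (wt : Weight n) where

  infix 4 _≻_

  _≻_ : Edge n → Edge n → Set
  (u , v) ≻ (u′ , v′) = wt u′ v′ ℚ.< wt u v
    ⊎ (wt u v ≡ wt u′ v′ × (toℕ u′ ℕ.< toℕ u ⊎ (u ≡ u′ × toℕ v′ ℕ.< toℕ v)))

  >β⇒≻ : ∀ a b → (wt ⊢ a >β b) ≡ true → a ≻ b
  >β⇒≻ (u , v) (u′ , v′) h with ∨-elim {does (wt u′ v′ ℚP.<? wt u v)} h
  ... | inj₁ lighter = inj₁ (does⇒ (wt u′ v′ ℚP.<? wt u v) lighter)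
  ... | inj₂ tie with ∨-elim (∧-elimʳ tie)
  ...   | inj₁ u′<u = inj₂ (does⇒ (wt u v ℚP.≟ wt u′ v′) (∧-elimˡ tie) , inj₁ (<ᵇ⇒< u′<u))
  ...   | inj₂ v′<v = inj₂ (does⇒ (wt u v ℚP.≟ wt u′ v′) (∧-elimˡ tie)
                          , inj₂ (=ᶠ⇒≡ u u′ (∧-elimˡ v′<v) , <ᵇ⇒< (∧-elimʳ v′<v)))

  ≻⇒>β : ∀ a b → a ≻ b → (wt ⊢ a >β b) ≡ true
  ≻⇒>β (u , v) (u′ , v′) (inj₁ lighter) = ∨-introˡ (dec-true (wt u′ v′ ℚP.<? wt u v) lighter)
  ≻⇒>β (u , v) (u′ , v′) (inj₂ (tie , inj₁ u′<u)) =
    ∨-introʳ {does (wt u′ v′ ℚP.<? wt u v)}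
      (∧-intro (dec-true (wt u v ℚP.≟ wt u′ v′) tie) (∨-introˡ (Equivalence.to T-≡ (ℕP.<⇒<ᵇ u′<u))))
  ≻⇒>β (u , v) (u′ , v′) (inj₂ (tie , inj₂ (u≡u′ , v′<v))) =
    ∨-introʳ {does (wt u′ v′ ℚP.<? wt u v)}
      (∧-intro (dec-true (wt u v ℚP.≟ wt u′ v′) tie)
        (∨-introʳ {toℕ u′ <ᵇ toℕ u} (∧-intro (≡⇒=ᶠ u≡u′) (Equivalence.to T-≡ (ℕP.<⇒<ᵇ v′<v)))))

  ≻-irrefl : ∀ a → ¬ a ≻ a
  ≻-irrefl _ (inj₁ p) = ℚP.<-irrefl refl p
  ≻-irrefl _ (inj₂ (_ , inj₁ p)) = ℕP.<-irrefl refl p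
  ≻-irrefl _ (inj₂ (_ , inj₂ (_ , p))) = ℕP.<-irrefl refl p

  ≻-trans : ∀ a b c → a ≻ b → b ≻ c → a ≻ c
  ≻-trans _ _ _ (inj₁ p) (inj₁ q) = inj₁ (ℚP.<-trans q p)
  ≻-trans (u , v) _ _ (inj₁ p) (inj₂ (w≡ , _)) = inj₁ (subst (ℚ._< wt u v) w≡ p)
  ≻-trans _ _ (u″ , v″) (inj₂ (w≡ , _)) (inj₁ q) = inj₁ (subst (wt u″ v″ ℚ.<_) (sym w≡) q)
  ≻-trans _ _ _ (inj₂ (w≡ , p)) (inj₂ (w≡′ , q)) = inj₂ (≡-trans w≡ w≡′ , lex p q)
    where
    lex : ∀ {u v u′ v′ u″ v″ : Fin n}
        → toℕ u′ ℕ.< toℕ u ⊎ (u ≡ u′ × toℕ v′ ℕ.< toℕ v)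
        → toℕ u″ ℕ.< toℕ u′ ⊎ (u′ ≡ u″ × toℕ v″ ℕ.< toℕ v′)
        → toℕ u″ ℕ.< toℕ u ⊎ (u ≡ u″ × toℕ v″ ℕ.< toℕ v)
    lex (inj₁ p) (inj₁ q) = inj₁ (ℕP.<-trans q p)
    lex (inj₁ p) (inj₂ (refl , _)) = inj₁ p
    lex (inj₂ (refl , _)) (inj₁ q) = inj₁ q
    lex (inj₂ (refl , p)) (inj₂ (refl , q)) = inj₂ (refl , ℕP.<-trans q p)

  ≻-total : ∀ a b → a ≢ b → a ≻ b ⊎ b ≻ a
  ≻-total (u , v) (u′ , v′) a≢b with ℚP.<-cmp (wt u v) (wt u′ v′)
  ... | tri< p _ _ = inj₂ (inj₁ p)
  ... | tri> _ _ p = inj₁ (inj₁ p)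
  ... | tri≈ _ w≡ _ with ℕP.<-cmp (toℕ u) (toℕ u′)
  ...   | tri< p _ _ = inj₂ (inj₂ (sym w≡ , inj₁ p))
  ...   | tri> _ _ p = inj₁ (inj₂ (w≡ , inj₁ p))
  ...   | tri≈ _ u≡ _ with toℕ-injective u≡
  ...     | refl with ℕP.<-cmp (toℕ v) (toℕ v′)
  ...       | tri< p _ _ = inj₂ (inj₂ (sym w≡ , inj₂ (refl , p)))
  ...       | tri> _ _ p = inj₁ (inj₂ (w≡ , inj₂ (refl , p)))
  ...       | tri≈ _ v≡ _ = contradiction (cong (u ,_) (toℕ-injective v≡)) a≢b

  ≻⇒wt≥ : ∀ a b → a ≻ b → wt (proj₁ b) (proj₂ b) ℚ.≤ wt (proj₁ a) (proj₂ a)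
  ≻⇒wt≥ _ _ (inj₁ p) = ℚP.<⇒≤ p
  ≻⇒wt≥ _ _ (inj₂ (w≡ , _)) = ℚP.≤-reflexive (sym w≡)

  edge≟ : (a b : Edge n) → Dec (a ≡ b)
  edge≟ = ≡-dec Fin._≟_ Fin._≟_

  IsLightest : (Edge n → Bool) → List (Edge n) → Edge n → Set
  IsLightest P xs x = x ∈ xs × P x ≡ true × (∀ y → y ∈ xs → P y ≡ true → y ≡ x ⊎ y ≻ x)

  lightest : ∀ (P : Edge n → Bool) xs → (∀ y → y ∈ xs → P y ≡ false) ⊎ ∃[ x ] IsLightest P xs x
  lightest P [] = inj₁ λ _ ()
  lightest P (z ∷ zs) with lightest P zs | P z in pz
  ... | inj₁ none | false = inj₁ λ { y (here refl) → pz ; y (there y∈) → none y y∈ }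
  ... | inj₁ none | true =
    inj₂ (z , here refl , pz , λ { y (here refl) _ → inj₁ refl
                                 ; y (there y∈) py → contradiction py (λ h → true≢false h (none y y∈)) })
  ... | inj₂ (x , x∈ , px , min) | false =
    inj₂ (x , there x∈ , px , λ { y (here refl) py → contradiction py (λ h → true≢false h pz)
                                ; y (there y∈) py → min y y∈ py })
  ... | inj₂ (x , x∈ , px , min) | true with edge≟ z x
  ...   | yes refl = inj₂ (x , here refl , px , λ { y (here refl) _ → inj₁ refl ; y (there y∈) py → min y y∈ py })
  ...   | no z≢x with ≻-total z x z≢x
  ...     | inj₁ z≻x = inj₂ (x , there x∈ , px , λ { y (here refl) _ → inj₂ z≻x ; y (there y∈) py → min y y∈ py })
  ...     | inj₂ x≻z = inj₂ (z , here refl , pz , λ { y (here refl) _ → inj₁ refl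
                                                     ; y (there y∈) py → inj₂ (heavier y (min y y∈ py)) })
    where
    heavier : ∀ y → y ≡ x ⊎ y ≻ x → y ≻ z
    heavier y (inj₁ refl) = x≻z
    heavier y (inj₂ y≻x) = ≻-trans y x z y≻x x≻z

  fewerHeavier⇒countᵇ≤ : ∀ {P Q : Edge n → Bool} xs m → Unique xs → (∀ y → P y ≡ true → Q y ≡ true)
                       → (∀ x → x ∈ xs → P x ≡ true → countᵇ (λ y → Q y ∧ (wt ⊢ y >β x)) xs ℕ.< m)
                       → countᵇ P xs ℕ.≤ m
  fewerHeavier⇒countᵇ≤ {P} {Q} xs m uniq P⇒Q fewer with lightest P xs
  ... | inj₁ none = ℕP.≤-trans (ℕP.≤-reflexive (countᵇ-zero xs none)) z≤n
  ... | inj₂ (x , x∈ , px , min) = begin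
    countᵇ P xs                                    ≤⟨ countᵇ-cover xs equalOrHeavier ⟩
    countᵇ (λ y → Q y ∧ (wt ⊢ y >β x)) xs + countᵇ isX xs ≤⟨ ℕP.+-monoʳ-≤ _ onlyOne ⟩
    countᵇ (λ y → Q y ∧ (wt ⊢ y >β x)) xs + 1      ≡⟨ ℕP.+-comm _ 1 ⟩
    suc (countᵇ (λ y → Q y ∧ (wt ⊢ y >β x)) xs)    ≤⟨ fewer x x∈ px ⟩
    m                                              ∎
    where
    open ℕP.≤-Reasoning
    isX : Edge n → Bool
    isX y = does (edge≟ y x)
    equalOrHeavier : ∀ y → y ∈ xs → P y ≡ true → (Q y ∧ (wt ⊢ y >β x)) ≡ true ⊎ isX y ≡ true
    equalOrHeavier y y∈ py with min y y∈ py
    ... | inj₁ y≡x = inj₂ (dec-true (edge≟ y x) y≡x)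
    ... | inj₂ y≻x = inj₁ (∧-intro (P⇒Q y py) (≻⇒>β y x y≻x))
    onlyOne : countᵇ isX xs ℕ.≤ 1
    onlyOne = countᵇ-≤1 xs uniq λ a b _ _ a≡x b≡x →
      ≡-trans (does⇒ (edge≟ a x) a≡x) (sym (does⇒ (edge≟ b x) b≡x))

module Matchings {n : ℕ} (k : ℕ) (wt : Weight n) (f : Colouring n k) where

  open Heaviness wt

  NiceKMatching : EdgeSet n → List (Edge n) → Set
  NiceKMatching = IsNiceKMatching k wt f

  incident : Fin (colours k) → Edge n → Bool
  incident = incidentTo k wt f

  colourList : List (Edge n) → List (Fin (colours k))
  colourList M = map f (endpoints k wt f M)

  length-colourList : ∀ M → length (colourList M) ≡ 2 * length M
  length-colourList [] = refl
  length-colourList (e ∷ M) =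
    ≡-trans (cong (suc ∘′ suc) (length-colourList M)) (sym (ℕP.*-suc 2 (length M)))

  niceKMatching : ∀ {S : EdgeSet n} {M} → length M ≡ k → All (_∈ₑ S) M → IsNice k wt f M → NiceKMatching S M
  niceKMatching len inS nice = len , inS , map⁻ nice , nice

  niceKMatching-⊆ : ∀ {S T : EdgeSet n} {M} → (∀ e → e ∈ₑ S → e ∈ₑ T) → NiceKMatching S M → NiceKMatching T M
  niceKMatching-⊆ S⊆T (len , inS , _ , nice) = niceKMatching len (All.map (S⊆T _) inS) nice

  endpoints-↭ : ∀ {M M′} → M ↭ M′ → endpoints k wt f M ↭ endpoints k wt f M′
  endpoints-↭ refl = refl
  endpoints-↭ (prep (a , b) p) = prep a (prep b (endpoints-↭ p))
  endpoints-↭ (swap (a , b) (c , d) p) = ↭.++⁺ (↭.++-comm (a ∷ b ∷ []) (c ∷ d ∷ [])) (endpoints-↭ p)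
  endpoints-↭ (trans p q) = trans (endpoints-↭ p) (endpoints-↭ q)

  niceKMatching-↭ : ∀ {S : EdgeSet n} {M M′} → M ↭ M′ → NiceKMatching S M → NiceKMatching S M′
  niceKMatching-↭ p (len , inS , _ , nice) =
    niceKMatching (≡-trans (sym (↭.↭-length p)) len) (↭.All-resp-↭ p inS)
      (unique-↭ (↭.map⁺ f (endpoints-↭ p)) nice)

  weight-↭ : ∀ {M M′} → M ↭ M′ → weight k wt f M ≡ weight k wt f M′
  weight-↭ refl = refl
  weight-↭ (prep (a , b) p) = cong (wt a b ℚ.+_) (weight-↭ p)
  weight-↭ {(a , b) ∷ (c , d) ∷ M} {_ ∷ _ ∷ M′} (swap _ _ p) = begin
    wt a b ℚ.+ (wt c d ℚ.+ weight k wt f M)    ≡⟨ sym (ℚP.+-assoc (wt a b) (wt c d) _) ⟩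
    (wt a b ℚ.+ wt c d) ℚ.+ weight k wt f M    ≡⟨ cong₂ ℚ._+_ (ℚP.+-comm (wt a b) (wt c d)) (weight-↭ p) ⟩
    (wt c d ℚ.+ wt a b) ℚ.+ weight k wt f M′   ≡⟨ ℚP.+-assoc (wt c d) (wt a b) _ ⟩
    wt c d ℚ.+ (wt a b ℚ.+ weight k wt f M′)   ∎
    where open ≡-Reasoning
  weight-↭ (trans p q) = ≡-trans (weight-↭ p) (weight-↭ q)

  Exchangeable : EdgeSet n → EdgeSet n → Set
  Exchangeable S T = ∀ e rest → NiceKMatching S (e ∷ rest) → ¬ e ∈ₑ T
                   → ∃[ e′ ] (e′ ∈ₑ S × e′ ≻ e × IsNice k wt f (e′ ∷ rest))

  heavierCount : EdgeSet n → Edge n → ℕ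
  heavierCount S e = countᵇ (λ e′ → memᵇ S e′ ∧ (wt ⊢ e′ >β e)) (allPairs n)

  heavierCount-< : ∀ S e e′ → e′ ∈ₑ S → e′ ≻ e → heavierCount S e′ ℕ.< heavierCount S e
  heavierCount-< S e e′ e′∈S e′≻e =
    countᵇ-strict (allPairs n) e′ heavierThanE (∈-allPairs e′)
      (¬true⇒false λ h → ≻-irrefl e′ (>β⇒≻ e′ e′ (∧-elimʳ {memᵇ S e′} h)))
      (∧-intro e′∈S (≻⇒>β e′ e e′≻e))
    where
    heavierThanE : ∀ x → (memᵇ S x ∧ (wt ⊢ x >β e′)) ≡ true → (memᵇ S x ∧ (wt ⊢ x >β e)) ≡ true
    heavierThanE x h =
      ∧-intro (∧-elimˡ h) (≻⇒>β x e (≻-trans x e′ e (>β⇒≻ x e′ (∧-elimʳ {memᵇ S x} h)) e′≻e))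

  potential : EdgeSet n → List (Edge n) → ℕ
  potential S M = sum (map (heavierCount S) M)

  potential-exchange : ∀ {S : EdgeSet n} {M e e′ rest} → M ↭ e ∷ rest → e′ ∈ₑ S → e′ ≻ e
                     → potential S (e′ ∷ rest) ℕ.< potential S M
  potential-exchange {S} {M} {e} {e′} {rest} M↭ e′∈S e′≻e = begin-strict
    heavierCount S e′ + potential S rest  <⟨ ℕP.+-monoˡ-< _ (heavierCount-< S e e′ e′∈S e′≻e) ⟩
    heavierCount S e + potential S rest   ≡⟨ sum-↭ (↭.map⁺ (heavierCount S) (↭-sym M↭)) ⟩
    potential S M                         ∎
    where open ℕP.≤-Reasoning

  weight-exchange : ∀ {M : List (Edge n)} {e e′ rest} → M ↭ e ∷ rest → e′ ≻ e
                  → weight k wt f M ℚ.≤ weight k wt f (e′ ∷ rest)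
  weight-exchange {M} {e} {e′} {rest} M↭ e′≻e = begin
    weight k wt f M                                   ≡⟨ weight-↭ M↭ ⟩
    wt (proj₁ e) (proj₂ e) ℚ.+ weight k wt f rest     ≤⟨ ℚP.+-monoˡ-≤ _ (≻⇒wt≥ e′ e e′≻e) ⟩
    wt (proj₁ e′) (proj₂ e′) ℚ.+ weight k wt f rest   ∎
    where open ℚP.≤-Reasoning

  allIn⊎outlier : ∀ (T : EdgeSet n) M → All (_∈ₑ T) M ⊎ ∃[ e ] ∃[ rest ] (M ↭ e ∷ rest × ¬ e ∈ₑ T)
  allIn⊎outlier T [] = inj₁ []
  allIn⊎outlier T (x ∷ M) with memᵇ T x in x∈?
  ... | false = inj₂ (x , M , refl , λ x∈T → true≢false x∈T x∈?)
  ... | true with allIn⊎outlier T M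
  ...   | inj₁ allIn = inj₁ (x∈? ∷ allIn)
  ...   | inj₂ (e , rest , M↭ , e∉T) = inj₂ (e , x ∷ rest , trans (prep x M↭) (swap x e refl) , e∉T)

  exchangeHead : ∀ {S : EdgeSet n} {e e′ rest} → NiceKMatching S (e ∷ rest) → e′ ∈ₑ S → IsNice k wt f (e′ ∷ rest)
               → NiceKMatching S (e′ ∷ rest)
  exchangeHead (len , _ ∷ inS , _) e′∈S nice′ = niceKMatching len (e′∈S ∷ inS) nice′

  transferAcc : ∀ {S T : EdgeSet n} → Exchangeable S T → ∀ M → NiceKMatching S M → Acc ℕ._<_ (potential S M)
              → ∃[ M′ ] (NiceKMatching T M′ × weight k wt f M ℚ.≤ weight k wt f M′)
  transferAcc {S} {T} exchange M nk@(len , _ , _ , nice) (acc smaller) with allIn⊎outlier T M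
  ... | inj₁ allIn = M , niceKMatching len allIn nice , ℚP.≤-refl
  ... | inj₂ (e , rest , M↭ , e∉T) = continue (exchange e rest nk′ e∉T)
    where
    nk′ : NiceKMatching S (e ∷ rest)
    nk′ = niceKMatching-↭ M↭ nk
    continue : ∃[ e′ ] (e′ ∈ₑ S × e′ ≻ e × IsNice k wt f (e′ ∷ rest))
             → ∃[ M′ ] (NiceKMatching T M′ × weight k wt f M ℚ.≤ weight k wt f M′)
    continue (e′ , e′∈S , e′≻e , nice′) =
      let M′ , nkT , heavier = transferAcc exchange (e′ ∷ rest) (exchangeHead nk′ e′∈S nice′)
                                 (smaller (potential-exchange M↭ e′∈S e′≻e))
      in M′ , nkT , ℚP.≤-trans (weight-exchange M↭ e′≻e) heavier

  transfer : ∀ {S T : EdgeSet n} {M} → Exchangeable S T → NiceKMatching S M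
           → ∃[ M′ ] (NiceKMatching T M′ × weight k wt f M ℚ.≤ weight k wt f M′)
  transfer exchange nk = transferAcc exchange _ nk (<-wellFounded _)

  hitsAny : List (Fin (colours k)) → Edge n → Bool
  hitsAny L e = any (λ c → incident c e) L

  hitsAny-false : ∀ L e → hitsAny L e ≡ false → f (proj₁ e) ∉ L × f (proj₂ e) ∉ L
  hitsAny-false [] _ _ = (λ ()) , (λ ())
  hitsAny-false (c ∷ L) (a , b) h with ∨-false {incident c (a , b)} h
  ... | atC , inL with ∨-false {f a =ᶠ c} atC | hitsAny-false L (a , b) inL
  ...   | a≠c , b≠c | a∉L , b∉L = ∉-∷ a≠c a∉L , ∉-∷ b≠c b∉L
    where
    ∉-∷ : ∀ {x} → (x =ᶠ c) ≡ false → x ∉ L → x ∉ c ∷ L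
    ∉-∷ x≠c _ (here x≡c) = true≢false (≡⇒=ᶠ x≡c) x≠c
    ∉-∷ _ x∉L (there x∈L) = x∉L x∈L

  countᵇ-hitsAny : ∀ (Q : Edge n → Bool) xs L B
                 → (∀ c → c ∈ L → countᵇ (λ e → Q e ∧ incident c e) xs ℕ.≤ B)
                 → countᵇ (λ e → Q e ∧ hitsAny L e) xs ℕ.≤ length L * B
  countᵇ-hitsAny Q xs [] B _ = ℕP.≤-reflexive (countᵇ-zero xs λ e _ → ∧-zeroʳ (Q e))
  countᵇ-hitsAny Q xs (c ∷ L) B bound =
    ℕP.≤-trans (countᵇ-cover xs split)
      (ℕP.+-mono-≤ (bound c (here refl)) (countᵇ-hitsAny Q xs L B λ c′ c′∈L → bound c′ (there c′∈L)))
    where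
    split : ∀ e → e ∈ xs → (Q e ∧ (incident c e ∨ hitsAny L e)) ≡ true
          → (Q e ∧ incident c e) ≡ true ⊎ (Q e ∧ hitsAny L e) ≡ true
    split e _ h with ∨-elim {incident c e} (∧-elimʳ {Q e} h)
    ... | inj₁ atC = inj₁ (∧-intro (∧-elimˡ h) atC)
    ... | inj₂ inL = inj₂ (∧-intro (∧-elimˡ h) inL)

  nice-∷ : ∀ e rest → f (proj₁ e) ≢ f (proj₂ e) → hitsAny (colourList rest) e ≡ false
         → IsNice k wt f rest → IsNice k wt f (e ∷ rest)
  nice-∷ (a , b) rest a≢b free nice with hitsAny-false (colourList rest) (a , b) free
  ... | a∉ , b∉ = (a≢b ∷ ¬Any⇒All¬ _ a∉) ∷ ¬Any⇒All¬ _ b∉ ∷ nice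

  freeHeavierEdge : ∀ (S : EdgeSet n) (P Q : Edge n → Bool) e rest B
                  → (∀ e′ → P e′ ≡ true → Q e′ ≡ true × e′ ∈ₑ S × e′ ≻ e)
                  → (∀ e′ → e′ ∈ₑ S → f (proj₁ e′) ≢ f (proj₂ e′))
                  → (∀ c → c ∈ colourList rest → countᵇ (λ e′ → Q e′ ∧ incident c e′) (allPairs n) ℕ.≤ B)
                  → length (colourList rest) * B ℕ.< countᵇ P (allPairs n)
                  → IsNice k wt f (e ∷ rest)
                  → ∃[ e′ ] (e′ ∈ₑ S × e′ ≻ e × IsNice k wt f (e′ ∷ rest))
  freeHeavierEdge S P Q e rest B candidate proper bound many (_ ∷ _ ∷ nice) =
    let e′ , _ , pe′ , free = pigeonhole {q = Q} {r = hitsAny (colourList rest)} (allPairs n)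
                                (λ x px → proj₁ (candidate x px))
                                (ℕP.≤-<-trans (countᵇ-hitsAny Q (allPairs n) (colourList rest) B bound) many)
        _ , e′∈S , e′≻e = candidate e′ pe′
    in e′ , e′∈S , e′≻e , nice-∷ e′ rest (proper e′ e′∈S) free nice

  nice⇒colours∉rest : ∀ e rest → IsNice k wt f (e ∷ rest)
                    → f (proj₁ e) ∉ colourList rest × f (proj₂ e) ∉ colourList rest
  nice⇒colours∉rest _ _ nice@(_ ∷ nice′) =
    (λ a∈ → Unique[x∷xs]⇒x∉xs nice (there a∈)) , Unique[x∷xs]⇒x∉xs nice′

  niceKMatching? : ∀ S M → Dec (NiceKMatching S M)
  niceKMatching? S M =
    (length M ℕ.≟ k) ×-dec (All.all? (λ e → memᵇ S e Bool.≟ true) M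
    ×-dec (UniqueDec.unique? Fin._≟_ _ ×-dec UniqueDec.unique? Fin._≟_ _))

  maxNiceKMatchingWeight : ∀ S → HasNiceKMatching k wt f S → ∃[ w ] IsMaxNiceKMatchingWeight k wt f S w
  maxNiceKMatchingWeight S (M₀ , nk₀) = weight k wt f best , (best , bestNice , refl) , bounded
    where
    open Extrema (DecTotalOrder.totalOrder ℚP.≤-decTotalOrder) using (argmax; argmax-all; f[xs]≤f[argmax])
    candidates : List (List (Edge n))
    candidates = filter (niceKMatching? S) (listsOfLength k (allPairs n))
    best : List (Edge n)
    best = argmax (weight k wt f) M₀ candidates
    bestNice : NiceKMatching S best
    bestNice = argmax-all (weight k wt f) nk₀ (all-filter (niceKMatching? S) (listsOfLength k (allPairs n)))
    bounded : ∀ M → NiceKMatching S M → weight k wt f M ℚ.≤ weight k wt f best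
    bounded M nk@(len , _) = All.lookup (f[xs]≤f[argmax] M₀ candidates)
      (∈-filter⁺ (niceKMatching? S) (subst (λ l → M ∈ listsOfLength l (allPairs n)) len
        (∈-listsOfLength ∈-allPairs M)) nk)

module Compaction {n : ℕ} (k : ℕ) (wt : Weight n) (f : Colouring n k) (H : EdgeSet n) where

  open Heaviness wt
  open Matchings k wt f

  C R′ R : EdgeSet n
  C = compact k wt f H
  R′ = reducedCompact′ k wt f H
  R = reducedCompact k wt f H

  heaviestAt : Fin (colours k) → Edge n → Bool
  heaviestAt = amongHeaviestAt k wt f C (2 * k)

  compact-properColours : ∀ e → e ∈ₑ C → f (proj₁ e) ≢ f (proj₂ e)
  compact-properColours (u , v) e∈C fu≡fv =
    true≢false (≡⇒=ᶠ fu≡fv)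
      (not-injective (∧-elimˡ (∧-elimʳ {memᵇ H (u , v)} (∧-elimˡ e∈C))))

  compact-heaviestBetween : ∀ e → e ∈ₑ C → ∀ e′ → e′ ∈ₑ H → sameClasses k wt f e e′ ≡ true → ¬ e′ ≻ e
  compact-heaviestBetween (u , v) e∈C e′ e′∈H same e′≻e =
    true≢false (∧-intro e′∈H (∧-intro same (≻⇒>β e′ (u , v) e′≻e)))
      (not-injective (allᵇ-∈ (allPairs n)
        (∧-elimʳ {not (f u =ᶠ f v)} (∧-elimʳ {memᵇ H (u , v)} (∧-elimˡ e∈C))) (∈-allPairs e′)))

  compact⊆H : ∀ e → e ∈ₑ C → e ∈ₑ H
  compact⊆H _ e∈C = ∧-elimˡ (∧-elimˡ e∈C)

  reducedCompact′⊆compact : ∀ e → e ∈ₑ R′ → e ∈ₑ C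
  reducedCompact′⊆compact _ e∈R′ = ∧-elimˡ (∧-elimˡ e∈R′)

  reducedCompact⊆compact : ∀ e → e ∈ₑ R → e ∈ₑ C
  reducedCompact⊆compact e e∈R = reducedCompact′⊆compact e (∧-elimˡ (∧-elimˡ e∈R))

  Joins : Fin (colours k) → Fin (colours k) → Edge n → Set
  Joins i c (a , b) = (f a ≡ i × f b ≡ c) ⊎ (f a ≡ c × f b ≡ i)

  incident⇒joins : ∀ i c e → i ≢ c → incident i e ≡ true → incident c e ≡ true → Joins i c e
  incident⇒joins i c (a , b) i≢c atI atC with ∨-elim {f a =ᶠ i} atI | ∨-elim {f a =ᶠ c} atC
  ... | inj₁ ai | inj₁ ac = ⊥-elim (i≢c (≡-trans (sym (=ᶠ⇒≡ (f a) i ai)) (=ᶠ⇒≡ (f a) c ac)))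
  ... | inj₁ ai | inj₂ bc = inj₁ (=ᶠ⇒≡ (f a) i ai , =ᶠ⇒≡ (f b) c bc)
  ... | inj₂ bi | inj₁ ac = inj₂ (=ᶠ⇒≡ (f a) c ac , =ᶠ⇒≡ (f b) i bi)
  ... | inj₂ bi | inj₂ bc = ⊥-elim (i≢c (≡-trans (sym (=ᶠ⇒≡ (f b) i bi)) (=ᶠ⇒≡ (f b) c bc)))

  joins⇒sameClasses : ∀ {i c} x y → Joins i c x → Joins i c y → sameClasses k wt f x y ≡ true
  joins⇒sameClasses _ _ (inj₁ (p , q)) (inj₁ (p′ , q′)) =
    ∨-introˡ (∧-intro (≡⇒=ᶠ (≡-trans p′ (sym p))) (≡⇒=ᶠ (≡-trans q′ (sym q))))
  joins⇒sameClasses _ _ (inj₂ (p , q)) (inj₂ (p′ , q′)) =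
    ∨-introˡ (∧-intro (≡⇒=ᶠ (≡-trans p′ (sym p))) (≡⇒=ᶠ (≡-trans q′ (sym q))))
  joins⇒sameClasses (u , v) (u′ , v′) (inj₁ (p , q)) (inj₂ (p′ , q′)) =
    ∨-introʳ {(f u′ =ᶠ f u) ∧ (f v′ =ᶠ f v)} (∧-intro (≡⇒=ᶠ (≡-trans p′ (sym q))) (≡⇒=ᶠ (≡-trans q′ (sym p))))
  joins⇒sameClasses (u , v) (u′ , v′) (inj₂ (p , q)) (inj₁ (p′ , q′)) =
    ∨-introʳ {(f u′ =ᶠ f u) ∧ (f v′ =ᶠ f v)} (∧-intro (≡⇒=ᶠ (≡-trans p′ (sym q))) (≡⇒=ᶠ (≡-trans q′ (sym p))))

  compactBetween : Fin (colours k) → Fin (colours k) → Edge n → Bool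
  compactBetween i c e = (memᵇ C e ∧ incident i e) ∧ incident c e

  compactBetween≤1 : ∀ i c → i ≢ c → countᵇ (compactBetween i c) (allPairs n) ℕ.≤ 1
  compactBetween≤1 i c i≢c = countᵇ-≤1 (allPairs n) (allPairs-unique n) equal
    where
    between : ∀ x → compactBetween i c x ≡ true → x ∈ₑ C × Joins i c x
    between x h = ∧-elimˡ (∧-elimˡ h)
                , incident⇒joins i c x i≢c (∧-elimʳ {memᵇ C x} (∧-elimˡ h)) (∧-elimʳ {memᵇ C x ∧ incident i x} h)
    equal : ∀ x y → x ∈ allPairs n → y ∈ allPairs n
          → compactBetween i c x ≡ true → compactBetween i c y ≡ true → x ≡ y
    equal x y _ _ hx hy with edge≟ x y | between x hx | between y hy
    ... | yes x≡y | _ | _ = x≡y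
    ... | no x≢y | x∈C , jx | y∈C , jy with ≻-total x y x≢y
    ...   | inj₁ x≻y = ⊥-elim (compact-heaviestBetween y y∈C x (compact⊆H x x∈C) (joins⇒sameClasses y x jy jx) x≻y)
    ...   | inj₂ y≻x = ⊥-elim (compact-heaviestBetween x x∈C y (compact⊆H y y∈C) (joins⇒sameClasses x y jx jy) y≻x)

  FewerHeavierAt : Fin (colours k) → Edge n → Set
  FewerHeavierAt c x = countᵇ (λ y → (memᵇ C y ∧ incident c y) ∧ (wt ⊢ y >β x)) (allPairs n) ℕ.< 2 * k

  heaviestAt⇒fewerHeavierAt : ∀ c x → heaviestAt c x ≡ true → FewerHeavierAt c x
  heaviestAt⇒fewerHeavierAt c x h =
    ℕP.≤-<-trans (countᵇ-mono (allPairs n) λ y _ hy → ≡-trans (sym (∧-assoc (memᵇ C y) (incident c y) _)) hy)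
      (<ᵇ⇒< h)

  reducedCompact′-heaviestAtEnds : ∀ a b → (a , b) ∈ₑ R′
                                 → heaviestAt (f a) (a , b) ≡ true × heaviestAt (f b) (a , b) ≡ true
  reducedCompact′-heaviestAtEnds a b e∈R′ =
    let atEnds = ∧-elimʳ {memᵇ C (a , b)} (∧-elimˡ e∈R′)
    in ∧-elimˡ atEnds , ∧-elimʳ {heaviestAt (f a) (a , b)} atEnds

  reducedCompact′-incident≤2k : ∀ c → countᵇ (λ e → memᵇ R′ e ∧ incident c e) (allPairs n) ℕ.≤ 2 * k
  reducedCompact′-incident≤2k c =
    fewerHeavier⇒countᵇ≤ {Q = λ y → memᵇ C y ∧ incident c y} (allPairs n) (2 * k) (allPairs-unique n) inC fewer
    where
    inC : ∀ y → (memᵇ R′ y ∧ incident c y) ≡ true → (memᵇ C y ∧ incident c y) ≡ true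
    inC y h = ∧-intro (reducedCompact′⊆compact y (∧-elimˡ h)) (∧-elimʳ {memᵇ R′ y} h)
    fewer : ∀ x → x ∈ allPairs n → (memᵇ R′ x ∧ incident c x) ≡ true → FewerHeavierAt c x
    fewer (a , b) _ h with reducedCompact′-heaviestAtEnds a b (∧-elimˡ h)
                         | ∨-elim {f a =ᶠ c} (∧-elimʳ {memᵇ R′ (a , b)} h)
    ... | atA , _ | inj₁ a~c =
      subst (λ d → FewerHeavierAt d (a , b)) (=ᶠ⇒≡ (f a) c a~c) (heaviestAt⇒fewerHeavierAt (f a) (a , b) atA)
    ... | _ , atB | inj₂ b~c =
      subst (λ d → FewerHeavierAt d (a , b)) (=ᶠ⇒≡ (f b) c b~c) (heaviestAt⇒fewerHeavierAt (f b) (a , b) atB)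

  compact-exchangeAt : ∀ e rest i → suc (length rest) ≡ k → IsNice k wt f (e ∷ rest)
                     → i ∉ colourList rest → heaviestAt i e ≡ false
                     → ∃[ e′ ] (e′ ∈ₑ C × e′ ≻ e × IsNice k wt f (e′ ∷ rest))
  compact-exchangeAt e rest i len nice i∉ notHeaviest =
    freeHeavierEdge C P (λ e′ → memᵇ C e′ ∧ incident i e′) e rest 1 candidate compact-properColours
      (λ c c∈ → compactBetween≤1 i c λ i≡c → i∉ (subst (_∈ colourList rest) (sym i≡c) c∈)) many nice
    where
    P : Edge n → Bool
    P e′ = memᵇ C e′ ∧ incident i e′ ∧ (wt ⊢ e′ >β e)
    candidate : ∀ e′ → P e′ ≡ true → (memᵇ C e′ ∧ incident i e′) ≡ true × e′ ∈ₑ C × e′ ≻ e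
    candidate e′ h = ∧-intro {memᵇ C e′} e′∈C (∧-elimˡ atI∧heavier) , e′∈C
                   , >β⇒≻ e′ e (∧-elimʳ {incident i e′} atI∧heavier)
      where
      e′∈C = ∧-elimˡ {memᵇ C e′} h
      atI∧heavier = ∧-elimʳ {memᵇ C e′} h
    many : length (colourList rest) * 1 ℕ.< countᵇ P (allPairs n)
    many = begin-strict
      length (colourList rest) * 1  ≡⟨ ℕP.*-identityʳ _ ⟩
      length (colourList rest)      ≡⟨ length-colourList rest ⟩
      2 * length rest               <⟨ double-< _ ⟩
      2 * suc (length rest)         ≡⟨ cong (2 *_) len ⟩
      2 * k                         ≤⟨ ≮ᵇ⇒≥ notHeaviest ⟩
      countᵇ P (allPairs n)         ∎
      where open ℕP.≤-Reasoning

  compact-exchangeable : Exchangeable C R′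
  compact-exchangeable (u , v) rest (len , e∈C ∷ _ , _ , nice) e∉R′
    with heaviestAt (f u) (u , v) in atU | heaviestAt (f v) (u , v) in atV
  ... | true  | true  = ⊥-elim (e∉R′ (∧-intro (∧-intro e∈C refl) (∧-elimʳ {C u v} e∈C)))
  ... | false | _     =
    compact-exchangeAt (u , v) rest (f u) len nice (proj₁ (nice⇒colours∉rest (u , v) rest nice)) atU
  ... | true  | false =
    compact-exchangeAt (u , v) rest (f v) len nice (proj₂ (nice⇒colours∉rest (u , v) rest nice)) atV

  reducedCompact′-exchangeable : Exchangeable R′ R
  reducedCompact′-exchangeable (u , v) rest (len , e∈R′ ∷ _ , _ , nice) e∉R
    with amongHeaviest k wt f R′ (colours k) (u , v) in top
  ... | true  = ⊥-elim (e∉R (∧-intro (∧-intro e∈R′ refl) (∧-elimʳ {R′ u v} e∈R′)))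
  ... | false =
    freeHeavierEdge R′ P (memᵇ R′) (u , v) rest (2 * k) candidate
      (λ e′ e′∈R′ → compact-properColours e′ (reducedCompact′⊆compact e′ e′∈R′))
      (λ c _ → reducedCompact′-incident≤2k c) many nice
    where
    P : Edge n → Bool
    P e′ = memᵇ R′ e′ ∧ (wt ⊢ e′ >β (u , v))
    candidate : ∀ e′ → P e′ ≡ true → memᵇ R′ e′ ≡ true × e′ ∈ₑ R′ × e′ ≻ (u , v)
    candidate e′ h = ∧-elimˡ h , ∧-elimˡ h , >β⇒≻ e′ (u , v) (∧-elimʳ {memᵇ R′ e′} h)
    many : length (colourList rest) * (2 * k) ℕ.< countᵇ P (allPairs n)
    many = begin-strict
      length (colourList rest) * (2 * k)  ≡⟨ cong (_* (2 * k)) (length-colourList rest) ⟩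
      2 * length rest * (2 * k)           <⟨ subst (λ m → 2 * length rest * (2 * m) ℕ.< colours m) len
                                               (double*double-< (length rest)) ⟩
      colours k                           ≤⟨ ≮ᵇ⇒≥ top ⟩
      countᵇ P (allPairs n)               ∎
      where open ℕP.≤-Reasoning

  compact→reduced : ∀ {M} → NiceKMatching C M
                  → ∃[ M′ ] (NiceKMatching R M′ × weight k wt f M ℚ.≤ weight k wt f M′)
  compact→reduced nk =
    let M₁ , nk₁ , w≤w₁ = transfer compact-exchangeable nk
        M₂ , nk₂ , w₁≤w₂ = transfer reducedCompact′-exchangeable nk₁
    in M₂ , nk₂ , ℚP.≤-trans w≤w₁ w₁≤w₂

  sameMaxWeight : HasNiceKMatching k wt f C
                → ∃[ w ] (IsMaxNiceKMatchingWeight k wt f C w × IsMaxNiceKMatchingWeight k wt f R w)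
  sameMaxWeight hasC with maxNiceKMatchingWeight C hasC
  ... | w , (M , nk , refl) , maximal =
    let M′ , nk′ , w≤w′ = compact→reduced nk
        maximalR = λ M″ nk″ → maximal M″ (niceKMatching-⊆ reducedCompact⊆compact nk″)
    in w , ((M , nk , refl) , maximal) , ((M′ , nk′ , ℚP.≤-antisym (maximalR M′ nk′) w≤w′) , maximalR)

lemma3p1 : (k : ℕ) → k ≥ 1 → (n : ℕ)
    → (E : EdgeSet n) (wt : Weight n)
    → (∀ e → e ∈ₑ E → 0ℚ ≤ wt (proj₁ e) (proj₂ e))
    → (f : Colouring n k) (H : EdgeSet n) → H ⊆ₑ E
    → (HasNiceKMatching k wt f (compact k wt f H) ⇔ HasNiceKMatching k wt f (reducedCompact k wt f H))
      × (HasNiceKMatching k wt f (compact k wt f H)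
         → ∃[ w ] (IsMaxNiceKMatchingWeight k wt f (compact k wt f H) w
                   × IsMaxNiceKMatchingWeight k wt f (reducedCompact k wt f H) w))
lemma3p1 k _ _ _ wt _ f H _ =
  mk⇔ (λ (_ , nk) → let M′ , nk′ , _ = compact→reduced nk in M′ , nk′)
      (λ (M , nk) → M , niceKMatching-⊆ reducedCompact⊆compact nk)
  , sameMaxWeight
  where
  open Matchings k wt f using (niceKMatching-⊆)
  open Compaction k wt f H using (compact→reduced; reducedCompact⊆compact; sameMaxWeight)
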